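{- Let $M_1=(X,\mathcal{I}_1)$ be a matroid and $M_2,\ldots,M_k$ partition matroids on $X$; let $\alpha=\chi(M_1)$ and $B=\sum_{i=2}^k(\chi(M_i)-1)$. Let $c$ be a feasible coloring of $i$ elements of $M=\bigcap_{i'=1}^kM_{i'}$ with colors in $[\alpha+B]$, $G$ the Edmonds digraph of $M_1$ with respect to $c$ (with $\alpha+B$ colors), and $H$ the color-chordless subgraph of $G$. Let $P$ be a source-sink path in $H$ that is suffix-feasible with respect to each of $M_2,\ldots,M_k$. Then $c\,\Delta\,P$ is a feasible coloring of $i+1$ elements of $M$ using colors in $[\alpha+B]$.
   Context: Partition matroid: a partition of $X$ into parts with positive integer capacities; a set is independent iff it meets each part in at most its capacity. Coloring $c:X\to\{0,\ldots,\alpha+B\}$, $0$ meaning uncolored; color classes $S_j=\{x:c(x)=j\}$; feasible in a matroid if each color class is independent there (feasible in $M$ if feasible in every $M_{i'}$). Edmonds digraph $G=(V,A)$: $V=[\alpha+B]\cup X$, $A=\bigcup_jA_j$, where $A_j$ contains $(j,x)$ for each $x\notin S_j$ with $S_j\cup\{x\}\in\mathcal{I}_1$, and, for each $x\notin S_j$ with $S_j\cup\{x\}\notin\mathcal{I}_1$, the arc $(y,x)$ for each $y\in S_j$ with $S_j-\{y\}\cup\{x\}\in\mathcal{I}_1$. Sources: color vertices $[\alpha+B]$; sinks: uncolored elements; a source-sink path is a directed path from a source to a sink. Color of color vertex $j$ is $j$; color of element $x$ is $c(x)$. Color-chordless subgraph $H$: layers $L_0=[\alpha+B]$ (no entering arcs),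 and inductively $L_t$ = vertices not in earlier layers having incoming arcs in $G$ from earlier-layer vertices of at least $B+1$ distinct colors; for each such $x$ choose $y_1,\ldots,y_{B+1}$ in earlier layers, of pairwise distinct colors, with $(y_s,x)\in A$, such that no vertex $z$ of the same color as $y_s$ in a layer earlier than $y_s$'s has $(z,x)\in A$; the arcs $(y_s,x)$ are the arcs of $H$ entering $x$; continue until no vertex qualifies. For a path $P=(x_1,\ldots,x_\ell=u)$ in $G$ ending at an uncolored $u$, $c\,\Delta\,P$ colors $x_t$ with $c(x_{t-1})$ for $3\le t\le\ell$; if $x_1$ is a color vertex then $x_2$ gets color $x_1$; otherwise $x_2$ gets color $c(x_1)$ and $x_1$ becomes uncolored; all else as in $c$. $P$ is suffix-feasible with respect to a matroid $N$ if for every suffix $(x_{\ell-s},\ldots,x_\ell)$ of $P$ ($s\ge0$), $c\,\Delta$ (that suffix) is a feasible coloring in $N$. -}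

module Defs where

open import Data.Nat using (ℕ; zero; suc; _+_; _≤_; _<_; _≡ᵇ_)
open import Data.Bool using (Bool; true; false; if_then_else_; not)
open import Data.Fin using (Fin; toℕ; _≟_)
open import Data.Fin.Subset using (Subset; inside; outside; ⊥; ⁅_⁆; _∈_; _∉_; _⊆_; _∪_; _∩_; _-_; ∣_∣)
open import Data.Vec using (tabulate)
open import Data.List using (List; []; _∷_; _∷ʳ_; drop; length)
open import Data.List.Relation.Unary.Linked using (Linked)
open import Data.List.Relation.Unary.Unique.Propositional using (Unique)
open import Data.Maybe using (Maybe; just; nothing)
open import Data.Product using (Σ; ∃; ∃-syntax; _×_; _,_)
open import Data.Sum using (_⊎_; inj₁; inj₂)
open import Relation.Nullary using (¬_; Dec; does)
open import Relation.Binary.PropositionalEquality using (_≡_; _≢_)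
open import Function.Definitions using (Injective)

∑ : ∀ {m} → (Fin m → ℕ) → ℕ
∑ {zero}  f = 0
∑ {suc m} f = f Fin.zero + ∑ (λ r → f (Fin.suc r))

IndepPred : ℕ → Set₁
IndepPred n = Subset n → Set

record Matroid (n : ℕ) : Set₁ where
  field
    Indep      : IndepPred n
    indep?     : (S : Subset n) → Dec (Indep S)
    indep-∅    : Indep ⊥
    indep-⊆    : ∀ {S T} → S ⊆ T → Indep T → Indep S
    indep-exch : ∀ {S T} → Indep S → Indep T → ∣ S ∣ < ∣ T ∣ →
                 ∃[ x ] (x ∈ T × x ∉ S × Indep (S ∪ ⁅ x ⁆))
open Matroid public

record PartitionMatroid (n : ℕ) : Set where
  field
    nparts  : ℕ
    part    : Fin n → Fin nparts
    cap     : Fin nparts → ℕ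
    cap-pos : ∀ q → 0 < cap q
open PartitionMatroid public

block : ∀ {n} (P : PartitionMatroid n) → Fin (nparts P) → Subset n
block P q = tabulate (λ x → does (part P x ≟ q))

IndepP : ∀ {n} → PartitionMatroid n → IndepPred n
IndepP P S = ∀ q → ∣ S ∩ block P q ∣ ≤ cap P q

preimage : ∀ {n k} → (Fin n → Fin k) → Fin k → Subset n
preimage f j = tabulate (λ x → does (f x ≟ j))

Colorable : ∀ {n} → IndepPred n → ℕ → Set
Colorable {n} I k = Σ (Fin n → Fin k) λ f → ∀ j → I (preimage f j)

IsChromaticNumber : ∀ {n} → IndepPred n → ℕ → Set
IsChromaticNumber I a = Colorable I a × (∀ k → Colorable I k → a ≤ k)

-- Colorings c : X → ℕ  (0 = uncolored)

Coloring : ℕ → Set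
Coloring n = Fin n → ℕ

class : ∀ {n} → Coloring n → ℕ → Subset n
class c j = tabulate (λ x → c x ≡ᵇ j)

colored : ∀ {n} → Coloring n → Subset n
colored c = tabulate (λ x → not (c x ≡ᵇ 0))

Feasible : ∀ {n} → IndepPred n → Coloring n → Set
Feasible I c = ∀ j → I (class c (suc j))

ColorsIn : ∀ {n} → ℕ → Coloring n → Set
ColorsIn K c = ∀ x → c x ≤ K

-- Edmonds digraph of a matroid (independence I) w.r.t. c with K colors.
-- Vertices: color vertices Fin K (vertex j stands for color suc (toℕ j))
-- and elements Fin n.

Vertex : ℕ → ℕ → Set
Vertex K n = Fin K ⊎ Fin n

colorOf : ∀ {K n} → Coloring n → Vertex K n → ℕ
colorOf c (inj₁ j) = suc (toℕ j)
colorOf c (inj₂ x) = c x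

data Arc {K n : ℕ} (I : IndepPred n) (c : Coloring n) : Vertex K n → Vertex K n → Set where
  src-arc  : ∀ (j : Fin K) x →
             x ∉ class c (suc (toℕ j)) →
             I (class c (suc (toℕ j)) ∪ ⁅ x ⁆) →
             Arc I c (inj₁ j) (inj₂ x)
  exch-arc : ∀ (j : Fin K) x y →
             x ∉ class c (suc (toℕ j)) →
             ¬ I (class c (suc (toℕ j)) ∪ ⁅ x ⁆) →
             y ∈ class c (suc (toℕ j)) →
             I ((class c (suc (toℕ j)) - y) ∪ ⁅ x ⁆) →
             Arc I c (inj₂ y) (inj₂ x)

module _ {K n : ℕ} where

  Before : (Vertex K n → Maybe ℕ) → ℕ → Vertex K n → Set
  Before layer t y = ∃[ s ] (layer y ≡ just s × s < t)

  EarlierThan : (Vertex K n → Maybe ℕ) → Vertex K n → Vertex K n → Set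
  EarlierThan layer y z = ∃[ a ] ∃[ b ] (layer y ≡ just a × layer z ≡ just b × a < b)

  Qualifies : IndepPred n → Coloring n → ℕ → (Vertex K n → Maybe ℕ) → ℕ → Vertex K n → Set
  Qualifies I c B layer t x =
    Σ (Fin (suc B) → Vertex K n) λ f →
      (∀ s → Before layer t (f s) × Arc I c (f s) x) ×
      Injective _≡_ _≡_ (λ s → colorOf c (f s))

record ColorChordless {n : ℕ} (I : IndepPred n) (K B : ℕ) (c : Coloring n) : Set where
  field
    layer      : Vertex K n → Maybe ℕ
    layer-src  : ∀ j → layer (inj₁ j) ≡ just 0
    layer-elem : ∀ x → layer (inj₂ x) ≢ just 0
    layer-suc⇒ : ∀ v t → layer v ≡ just (suc t) →
                 ¬ Before layer (suc t) v × Qualifies I c B layer (suc t) v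
    layer-suc⇐ : ∀ v t → ¬ Before layer (suc t) v → Qualifies I c B layer (suc t) v →
                 layer v ≡ just (suc t)
    -- the B+1 chosen tails of the H-arcs entering x (meaningful for layered x ∉ L₀)
    pred       : Vertex K n → Fin (suc B) → Vertex K n
    pred-ok    : ∀ x t → layer x ≡ just (suc t) →
                 (∀ s → Before layer (suc t) (pred x s) × Arc I c (pred x s) x) ×
                 Injective _≡_ _≡_ (λ s → colorOf c (pred x s)) ×
                 (∀ s z → colorOf c z ≡ colorOf c (pred x s) →
                          EarlierThan layer z (pred x s) → ¬ Arc I c z x)
open ColorChordless public

HArc : ∀ {n I K B c} → ColorChordless {n} I K B c → Vertex K n → Vertex K n → Set
HArc H y x = ∃[ t ] (layer H x ≡ just (suc t) × ∃[ s ] (pred H x s ≡ y))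

IsSourceSinkPath : ∀ {n I K B c} → ColorChordless {n} I K B c → List (Vertex K n) → Set
IsSourceSinkPath {c = c} H P =
  Linked (HArc H) P × Unique P ×
  (∃[ j ] ∃[ ys ] (P ≡ inj₁ j ∷ ys)) ×
  (∃[ u ] ∃[ zs ] (P ≡ zs ∷ʳ inj₂ u × c u ≡ 0))

setV : ∀ {K n} → Vertex K n → ℕ → Coloring n → Coloring n
setV (inj₁ _) k d = d
setV (inj₂ x) k d y = if does (y ≟ x) then k else d y

-- x_t gets the color (in c) of x_{t-1}, for t ≥ 2
shiftAlong : ∀ {K n} → Coloring n → List (Vertex K n) → Coloring n → Coloring n
shiftAlong c []           d = d
shiftAlong c (v ∷ [])     d = d
shiftAlong c (v ∷ w ∷ ws) d = shiftAlong c (w ∷ ws) (setV w (colorOf c v) d)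

-- if x_1 is an element it becomes uncolored
_Δ_ : ∀ {K n} → Coloring n → List (Vertex K n) → Coloring n
c Δ []      = c
c Δ (v ∷ P) = shiftAlong c (v ∷ P) (setV v 0 c)

SuffixFeasible : ∀ {K n} → IndepPred n → Coloring n → List (Vertex K n) → Set
SuffixFeasible I c P = ∀ m → m < length P → Feasible I (c Δ drop m P)

{-# OPTIONS --safe #-}
-- Feasibility in the partition matroids is the whole-path case of suffix-feasibility, and
-- the new colours stay in range because each is the colour of a path vertex; the chromatic
-- numbers matter only through the number of colours.  The content is feasibility in M₁.
--
-- Walk along P = (j, x₂, …, u), giving each element the old colour of its predecessor.
-- Once the current element v has been recoloured, every colour class is independent,
-- except that the old class of v is only known to stay independent with v put back, and
-- only v and elements of earlier layers have changed colour.  Recolouring the next element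
-- w with the old colour J of v replaces v by w in that class T.  The exchange arc says that
-- w may replace v in the original class S.  The elements of S that have left T lie in
-- earlier layers, so by colour-chordlessness none of them has an arc to w: the circuit of
-- w in S lies in (S ∩ T) + v, and the exchange transfers from S ∩ T to T.
module Submission where

open import Defs
open import Data.Bool using (Bool; true; false; not; if_then_else_)
open import Data.Bool.Properties using (T-≡)
open import Data.Empty using (⊥)
open import Data.Fin as Fin using (Fin; toℕ)
open import Data.Fin.Properties using (any?; toℕ<n; suc-injective)
open import Data.Fin.Subset using (Subset; inside; outside; ⁅_⁆; _∈_; _∉_; _⊆_; _∪_; _∩_; _-_; ∣_∣)
open import Data.Fin.Subset.Properties
  using (_∈?_; x∈⁅x⁆; x∈⁅y⁆⇒x≡y; p⊆p∪q; q⊆p∪q; x∈p∪q⁻; p∩q⊆p; p∩q⊆q; x∈p∩q⁺;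
         x∈p∧x≢y⇒x∈p-y; x∈p⇒∣p-x∣<∣p∣; p⊆q⇒∣p∣≤∣q∣; p⊂q⇒∣p∣<∣q∣; ∪-identityʳ)
open import Data.List using (List; []; _∷_; _∷ʳ_; length)
open import Data.List.Properties using (∷-injectiveʳ; ∷ʳ-injectiveʳ)
open import Data.List.Relation.Unary.Linked using (Linked; _∷_)
open import Data.Maybe using (Maybe)
open import Data.Maybe.Properties using (just-injective)
open import Data.Nat using (ℕ; zero; suc; _+_; _∸_; _≤_; _<_; _≡ᵇ_; z≤n; s≤s; _≤?_; _≟_)
open import Data.Nat.Properties
  using (≤-refl; ≤-trans; ≤-reflexive; n≤1+n; ≤-<-trans; <-≤-trans; <-irrefl; <-asym; <-trans;
         ≰⇒>; +-suc; +-monoʳ-≤; m≤m+n; ≡ᵇ⇒≡; ≡⇒≡ᵇ; 1+n≢0; 0≢1+n)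
open import Data.Product using (∃-syntax; _×_; _,_; proj₁; proj₂)
open import Data.Sum using (_⊎_; inj₁; inj₂; map₂)
open import Data.Vec using (tabulate; _∷_)
open import Data.Vec.Properties using (lookup⇒[]=; []=⇒lookup; lookup∘tabulate; tabulate-cong)
open import Function using (_∘_; id)
open import Function.Bundles using (Equivalence)
open import Relation.Binary.PropositionalEquality using (_≡_; _≢_; refl; sym; trans; cong)
open import Relation.Nullary using (¬_; Dec; does; yes; no; contradiction; ¬?; _×-dec_; decidable-stable)

variable
  n : ℕ
  p q : Subset n
  x y : Fin n

∈-tabulate⁺ : (f : Fin n → Bool) → f x ≡ true → x ∈ tabulate f
∈-tabulate⁺ {x = x} f fx≡true = lookup⇒[]= x (tabulate f) (trans (lookup∘tabulate f x) fx≡true)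

∈-tabulate⁻ : (f : Fin n → Bool) → x ∈ tabulate f → f x ≡ true
∈-tabulate⁻ {x = x} f x∈ = trans (sym (lookup∘tabulate f x)) ([]=⇒lookup x∈)

∣tabulate∣-flip : (f g : Fin n → Bool) (u : Fin n) → (∀ x → x ≢ u → f x ≡ g x) →
                  f u ≡ false → g u ≡ true → ∣ tabulate g ∣ ≡ suc ∣ tabulate f ∣
∣tabulate∣-flip f g Fin.zero agree fu gu
  rewrite fu | gu | tabulate-cong (λ x → agree (Fin.suc x) λ ()) = refl
∣tabulate∣-flip f g (Fin.suc u) agree fu gu
  with f Fin.zero | g Fin.zero | agree Fin.zero (λ ())
     | ∣tabulate∣-flip (f ∘ Fin.suc) (g ∘ Fin.suc) u
                       (λ x x≢u → agree (Fin.suc x) (x≢u ∘ suc-injective)) fu gu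
... | true  | true  | refl | flip-tail = cong suc flip-tail
... | false | false | refl | flip-tail = flip-tail

∈-∪⁅⁆⁻ : x ∈ p ∪ ⁅ y ⁆ → x ∈ p ⊎ x ≡ y
∈-∪⁅⁆⁻ {p = p} {y = y} x∈ = map₂ (x∈⁅y⁆⇒x≡y y) (x∈p∪q⁻ p ⁅ y ⁆ x∈)

x∈p∪⁅x⁆ : (p : Subset n) (x : Fin n) → x ∈ p ∪ ⁅ x ⁆
x∈p∪⁅x⁆ p x = q⊆p∪q p ⁅ x ⁆ (x∈⁅x⁆ x)

∪⁅⁆-lub : p ⊆ q → x ∈ q → p ∪ ⁅ x ⁆ ⊆ q
∪⁅⁆-lub p⊆q x∈q z∈ with ∈-∪⁅⁆⁻ z∈
... | inj₁ z∈p = p⊆q z∈p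
... | inj₂ refl = x∈q

∪⁅⁆-monoˡ : p ⊆ q → p ∪ ⁅ x ⁆ ⊆ q ∪ ⁅ x ⁆
∪⁅⁆-monoˡ {q = q} {x = x} p⊆q = ∪⁅⁆-lub (p⊆p∪q ⁅ x ⁆ ∘ p⊆q) (x∈p∪⁅x⁆ q x)

∣p∪⁅x⁆∣≤1+∣p∣ : (p : Subset n) (x : Fin n) → ∣ p ∪ ⁅ x ⁆ ∣ ≤ suc ∣ p ∣
∣p∪⁅x⁆∣≤1+∣p∣ (inside  ∷ p) Fin.zero    rewrite ∪-identityʳ p = n≤1+n _
∣p∪⁅x⁆∣≤1+∣p∣ (outside ∷ p) Fin.zero    rewrite ∪-identityʳ p = ≤-refl
∣p∪⁅x⁆∣≤1+∣p∣ (inside  ∷ p) (Fin.suc x) = s≤s (∣p∪⁅x⁆∣≤1+∣p∣ p x)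
∣p∪⁅x⁆∣≤1+∣p∣ (outside ∷ p) (Fin.suc x) = ∣p∪⁅x⁆∣≤1+∣p∣ p x

x∉p⇒∣p∣<∣p∪⁅x⁆∣ : (p : Subset n) (x : Fin n) → x ∉ p → ∣ p ∣ < ∣ p ∪ ⁅ x ⁆ ∣
x∉p⇒∣p∣<∣p∪⁅x⁆∣ p x x∉p = p⊂q⇒∣p∣<∣q∣ (p⊆p∪q ⁅ x ⁆ , x , x∈p∪⁅x⁆ p x , x∉p)

p⊆q∧∣q∣≤∣p∣⇒q⊆p : p ⊆ q → ∣ q ∣ ≤ ∣ p ∣ → q ⊆ p
p⊆q∧∣q∣≤∣p∣⇒q⊆p {p = p} {q = q} p⊆q ∣q∣≤∣p∣ {x} x∈q =
  decidable-stable (x ∈? p) λ x∉p → <-irrefl refl (<-≤-trans (∣p∣<∣q∣ x∉p) ∣q∣≤∣p∣)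
  where
  ∣p∣<∣q∣ : x ∉ p → ∣ p ∣ < ∣ q ∣
  ∣p∣<∣q∣ x∉p = ≤-<-trans (p⊆q⇒∣p∣≤∣q∣ p⊆q-x) (x∈p⇒∣p-x∣<∣p∣ x∈q)
    where
    p⊆q-x : p ⊆ q - x
    p⊆q-x z∈p = x∈p∧x≢y⇒x∈p-y (p⊆q z∈p) λ { refl → x∉p z∈p }

⊆⊎∃∉ : (p q : Subset n) → p ⊆ q ⊎ ∃[ x ] (x ∈ p × x ∉ q)
⊆⊎∃∉ p q with any? (λ x → x ∈? p ×-dec ¬? (x ∈? q))
... | yes witness = inj₂ witness
... | no none     = inj₁ λ {x} x∈p → decidable-stable (x ∈? q) λ x∉q → none (x , x∈p , x∉q)

module MatroidProperties (M : Matroid n) where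

  private
    I : IndepPred n
    I = Indep M

  record Augmentation (A T : Subset n) : Set where
    field
      E       : Subset n
      A⊆E     : A ⊆ E
      E⊆A∪T   : E ⊆ A ∪ T
      indep-E : I E
      ∣T∣≤∣E∣ : ∣ T ∣ ≤ ∣ E ∣

  augmentation-∪⁅⁆ : ∀ {A T x} → x ∈ T → Augmentation (A ∪ ⁅ x ⁆) T → Augmentation A T
  augmentation-∪⁅⁆ {A} {T} {x} x∈T aug = record
    { E = E ; A⊆E = A⊆E ∘ p⊆p∪q ⁅ x ⁆ ; E⊆A∪T = E⊆A∪T′ ; indep-E = indep-E ; ∣T∣≤∣E∣ = ∣T∣≤∣E∣ }
    where
    open Augmentation aug
    E⊆A∪T′ : E ⊆ A ∪ T
    E⊆A∪T′ z∈E with x∈p∪q⁻ (A ∪ ⁅ x ⁆) T (E⊆A∪T z∈E)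
    ... | inj₂ z∈T = q⊆p∪q A T z∈T
    ... | inj₁ z∈A+x with ∈-∪⁅⁆⁻ z∈A+x
    ...   | inj₁ z∈A = p⊆p∪q T z∈A
    ...   | inj₂ refl = q⊆p∪q A T x∈T

  augment-within : ∀ gap {A T} → I A → I T → ∣ T ∣ ≤ gap + ∣ A ∣ → Augmentation A T
  augment-within gap {A} {T} iA iT bound with ∣ T ∣ ≤? ∣ A ∣
  ... | yes ∣T∣≤∣A∣ = record { E = A ; A⊆E = id ; E⊆A∪T = p⊆p∪q T ; indep-E = iA ; ∣T∣≤∣E∣ = ∣T∣≤∣A∣ }
  augment-within zero       iA iT bound | no ∣T∣≰∣A∣ = contradiction bound ∣T∣≰∣A∣
  augment-within (suc gap) {A} {T} iA iT bound | no ∣T∣≰∣A∣ with indep-exch M iA iT (≰⇒> ∣T∣≰∣A∣)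
  ... | x , x∈T , x∉A , iA+x = augmentation-∪⁅⁆ x∈T (augment-within gap iA+x iT bound′)
    where
    bound′ : ∣ T ∣ ≤ gap + ∣ A ∪ ⁅ x ⁆ ∣
    bound′ = ≤-trans bound (≤-trans (≤-reflexive (sym (+-suc gap ∣ A ∣)))
                                    (+-monoʳ-≤ gap (x∉p⇒∣p∣<∣p∪⁅x⁆∣ A x x∉A)))

  augment : ∀ {A T} → I A → I T → Augmentation A T
  augment {A} {T} iA iT = augment-within ∣ T ∣ iA iT (m≤m+n ∣ T ∣ ∣ A ∣)

  indep-by-size : ∀ {E R} → I E → E ⊆ R → ∣ R ∣ ≤ ∣ E ∣ → I R
  indep-by-size iE E⊆R ∣R∣≤∣E∣ = indep-⊆ M (p⊆q∧∣q∣≤∣p∣⇒q⊆p E⊆R ∣R∣≤∣E∣) iE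

  -- The fundamental circuit of x in S is x together with the y for which (S - y) + x is
  -- independent, so it lies in D + x.
  dependent-on-subset : ∀ {S D x} → I S → D ⊆ S → ¬ I (S ∪ ⁅ x ⁆) →
                        (∀ y → y ∈ S → y ∉ D → ¬ I ((S - y) ∪ ⁅ x ⁆)) → ¬ I (D ∪ ⁅ x ⁆)
  dependent-on-subset {S} {D} {x} iS D⊆S S+x-dep unexchangeable iD+x = use (⊆⊎∃∉ S E)
    where
    open Augmentation (augment iD+x iS)
    use : S ⊆ E ⊎ ∃[ y ] (y ∈ S × y ∉ E) → ⊥
    use (inj₁ S⊆E) = S+x-dep (indep-⊆ M (∪⁅⁆-lub S⊆E (A⊆E (x∈p∪⁅x⁆ D x))) indep-E)
    use (inj₂ (y , y∈S , y∉E)) =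
      unexchangeable y y∈S (y∉E ∘ A⊆E ∘ p⊆p∪q ⁅ x ⁆)
        (indep-by-size indep-E E⊆S-y+x
          (≤-trans (∣p∪⁅x⁆∣≤1+∣p∣ (S - y) x) (≤-trans (x∈p⇒∣p-x∣<∣p∣ y∈S) ∣T∣≤∣E∣)))
      where
      E⊆S-y+x : E ⊆ (S - y) ∪ ⁅ x ⁆
      E⊆S-y+x {z} z∈E with x∈p∪q⁻ (D ∪ ⁅ x ⁆) S (E⊆A∪T z∈E)
      ... | inj₂ z∈S = p⊆p∪q ⁅ x ⁆ (x∈p∧x≢y⇒x∈p-y z∈S λ { refl → y∉E z∈E })
      ... | inj₁ z∈D+x with ∈-∪⁅⁆⁻ z∈D+x
      ...   | inj₁ z∈D = p⊆p∪q ⁅ x ⁆ (x∈p∧x≢y⇒x∈p-y (D⊆S z∈D) λ { refl → y∉E z∈E })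
      ...   | inj₂ refl = x∈p∪⁅x⁆ (S - y) x

  replacement-lifts : ∀ {T D x y} → y ∉ T → I (T ∪ ⁅ y ⁆) → D ⊆ T → I (D ∪ ⁅ x ⁆) →
                      ¬ I ((D ∪ ⁅ y ⁆) ∪ ⁅ x ⁆) → I (T ∪ ⁅ x ⁆)
  replacement-lifts {T} {D} {x} {y} y∉T iT+y D⊆T iD+x D+y+x-dep = use (y ∈? E)
    where
    open Augmentation (augment iD+x iT+y)
    use : Dec (y ∈ E) → I (T ∪ ⁅ x ⁆)
    use (yes y∈E) = contradiction (indep-⊆ M D+y+x⊆E indep-E) D+y+x-dep
      where
      D+y+x⊆E : (D ∪ ⁅ y ⁆) ∪ ⁅ x ⁆ ⊆ E
      D+y+x⊆E = ∪⁅⁆-lub (∪⁅⁆-lub (A⊆E ∘ p⊆p∪q ⁅ x ⁆) y∈E) (A⊆E (x∈p∪⁅x⁆ D x))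
    use (no y∉E) = indep-by-size indep-E E⊆T+x
                     (≤-trans (∣p∪⁅x⁆∣≤1+∣p∣ T x) (≤-trans (x∉p⇒∣p∣<∣p∪⁅x⁆∣ T y y∉T) ∣T∣≤∣E∣))
      where
      E⊆T+x : E ⊆ T ∪ ⁅ x ⁆
      E⊆T+x {z} z∈E with x∈p∪q⁻ (D ∪ ⁅ x ⁆) (T ∪ ⁅ y ⁆) (E⊆A∪T z∈E)
      ... | inj₁ z∈D+x = ∪⁅⁆-monoˡ D⊆T z∈D+x
      ... | inj₂ z∈T+y with ∈-∪⁅⁆⁻ z∈T+y
      ...   | inj₁ z∈T = p⊆p∪q ⁅ x ⁆ z∈T
      ...   | inj₂ refl = contradiction z∈E y∉E

∈-class⁺ : (d : Coloring n) {J : ℕ} → d x ≡ J → x ∈ class d J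
∈-class⁺ {x = x} d {J} dx≡J = ∈-tabulate⁺ _ (Equivalence.to T-≡ (≡⇒≡ᵇ (d x) J dx≡J))

∈-class⁻ : (d : Coloring n) {J : ℕ} → x ∈ class d J → d x ≡ J
∈-class⁻ {x = x} d {J} x∈ = ≡ᵇ⇒≡ (d x) J (Equivalence.from T-≡ (∈-tabulate⁻ _ x∈))

≢0⇒≡ᵇ0≡false : ∀ {m} → m ≢ 0 → (m ≡ᵇ 0) ≡ false
≢0⇒≡ᵇ0≡false {zero}  m≢0 = contradiction refl m≢0
≢0⇒≡ᵇ0≡false {suc m} _   = refl

-- Definitionally setV (inj₂ w) for every vertex count K, which setV could not infer here.
recolor : Fin n → ℕ → Coloring n → Coloring n
recolor w k d y = if does (y Fin.≟ w) then k else d y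

module _ (w : Fin n) (k : ℕ) (d : Coloring n) where

  recolor-updates : recolor w k d w ≡ k
  recolor-updates with w Fin.≟ w
  ... | yes _   = refl
  ... | no w≢w = contradiction refl w≢w

  recolor-minimal : y ≢ w → recolor w k d y ≡ d y
  recolor-minimal {y = y} y≢w with y Fin.≟ w
  ... | yes y≡w = contradiction y≡w y≢w
  ... | no _    = refl

  class-recolor⊆class∪⁅⁆ : ∀ {J} → class (recolor w k d) J ⊆ class d J ∪ ⁅ w ⁆
  class-recolor⊆class∪⁅⁆ {J} {z} z∈ with z Fin.≟ w
  ... | yes refl = x∈p∪⁅x⁆ (class d J) z
  ... | no z≢w   =
    p⊆p∪q ⁅ w ⁆ (∈-class⁺ d (trans (sym (recolor-minimal z≢w)) (∈-class⁻ (recolor w k d) z∈)))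

  class-recolor⊆class : ∀ {J} → k ≢ J → class (recolor w k d) J ⊆ class d J
  class-recolor⊆class {J} k≢J {z} z∈ with z Fin.≟ w
  ... | yes refl = contradiction (trans (sym recolor-updates) (∈-class⁻ (recolor w k d) z∈)) k≢J
  ... | no z≢w   = ∈-class⁺ d (trans (sym (recolor-minimal z≢w)) (∈-class⁻ (recolor w k d) z∈))

colorOf≤ : ∀ {K} {c : Coloring n} → ColorsIn K c → (v : Vertex K n) → colorOf c v ≤ K
colorOf≤ c-in (inj₁ j) = toℕ<n j
colorOf≤ c-in (inj₂ x) = c-in x

setV-colorsIn : ∀ {K K′ k} {d : Coloring n} → ColorsIn K d → k ≤ K → (v : Vertex K′ n) →
                ColorsIn K (setV v k d)
setV-colorsIn d-in k≤K (inj₁ _) = d-in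
setV-colorsIn d-in k≤K (inj₂ w) x with x Fin.≟ w
... | yes _ = k≤K
... | no _  = d-in x

shiftAlong-colorsIn : ∀ {K} {c d : Coloring n} (P : List (Vertex K n)) →
                      ColorsIn K c → ColorsIn K d → ColorsIn K (shiftAlong c P d)
shiftAlong-colorsIn []           c-in d-in = d-in
shiftAlong-colorsIn (v ∷ [])     c-in d-in = d-in
shiftAlong-colorsIn (v ∷ w ∷ ws) c-in d-in =
  shiftAlong-colorsIn (w ∷ ws) c-in (setV-colorsIn d-in (colorOf≤ c-in v) w)

Δ-colorsIn : ∀ {K} {c : Coloring n} (P : List (Vertex K n)) → ColorsIn K c → ColorsIn K (c Δ P)
Δ-colorsIn []      c-in = c-in
Δ-colorsIn (v ∷ P) c-in = shiftAlong-colorsIn (v ∷ P) c-in (setV-colorsIn c-in z≤n v)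

module LayerOrder {K : ℕ} (layer : Vertex K n → Maybe ℕ) where

  EarlierThan-trans : ∀ {u v w} → EarlierThan layer u v → EarlierThan layer v w → EarlierThan layer u w
  EarlierThan-trans (a , b , la , lb , a<b) (b′ , c , lb′ , lc , b′<c)
    with refl ← just-injective (trans (sym lb) lb′) = a , c , la , lc , <-trans a<b b′<c

  EarlierThan-asym : ∀ {u v} → EarlierThan layer u v → ¬ EarlierThan layer v u
  EarlierThan-asym (a , b , la , lb , a<b) (b′ , a′ , lb′ , la′ , b′<a′)
    with refl ← just-injective (trans (sym la) la′) | refl ← just-injective (trans (sym lb) lb′) =
    <-asym a<b b′<a′

  EarlierThan-irrefl : ∀ {v} → ¬ EarlierThan layer v v
  EarlierThan-irrefl v<v = EarlierThan-asym v<v v<v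

module Walk {K B : ℕ} (M : Matroid n) (c : Coloring n) (H : ColorChordless (Indep M) K B c)
            (c-feasible : Feasible (Indep M) c) where

  open MatroidProperties M
  open LayerOrder (layer H)

  private
    I : IndepPred n
    I = Indep M
    Earlier : Vertex K n → Vertex K n → Set
    Earlier = EarlierThan (layer H)

  record ChordlessArc (y x : Vertex K n) : Set where
    field
      arc      : Arc I c y x
      earlier  : Earlier y x
      no-chord : ∀ z → colorOf c z ≡ colorOf c y → Earlier z y → ¬ Arc I c z x

  hArc⇒chordless : ∀ {y x} → HArc H y x → ChordlessArc y x
  hArc⇒chordless {x = x} (t , x∈Lt , s , refl)
    with tails , _ , no-chord ← pred-ok H x t x∈Lt
    with (a , la , a<t) , arc ← tails s =
    record { arc = arc ; earlier = a , suc t , la , x∈Lt , a<t ; no-chord = no-chord s }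

  ¬hArc-into-source : ∀ {y j} → ¬ HArc H y (inj₁ j)
  ¬hArc-into-source {j = j} (t , j∈Lt , _) = 0≢1+n (just-injective (trans (sym (layer-src H j)) j∈Lt))

  record Invariant (v : Fin n) (d : Coloring n) : Set where
    field
      current-class     : ∀ j → c v ≡ suc j → I (class d (suc j) ∪ ⁅ v ⁆)
      other-classes     : ∀ j → c v ≢ suc j → I (class d (suc j))
      changed-earlier   : ∀ x → d x ≢ c x → x ≡ v ⊎ Earlier (inj₂ x) (inj₂ v)
      current-changed   : d v ≢ c v
      current-colored   : d v ≢ 0
      colored-elsewhere : ∀ x → x ≢ v → (d x ≡ᵇ 0) ≡ (c x ≡ᵇ 0)
  open Invariant

  invariant-start : ∀ {j : Fin K} {w} → Arc I c (inj₁ j) (inj₂ w) → Invariant w (recolor w (suc (toℕ j)) c)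
  invariant-start (src-arc j w w∉S iS+w) = record
    { current-class     = current
    ; other-classes     = others
    ; changed-earlier   = λ x dx≢cx → inj₁ (decidable-stable (x Fin.≟ w) (dx≢cx ∘ recolor-minimal w J c))
    ; current-changed   = λ dw≡cw → J≢ refl (trans (sym (recolor-updates w J c)) dw≡cw)
    ; current-colored   = λ dw≡0 → 1+n≢0 (trans (sym (recolor-updates w J c)) dw≡0)
    ; colored-elsewhere = λ x x≢w → cong (_≡ᵇ 0) (recolor-minimal w J c x≢w)
    }
    where
    J : ℕ
    J = suc (toℕ j)
    J≢ : ∀ {J′} → c w ≡ J′ → J ≢ J′
    J≢ cw≡J′ J≡J′ = w∉S (∈-class⁺ c (trans cw≡J′ (sym J≡J′)))
    current : ∀ j′ → c w ≡ suc j′ → I (class (recolor w J c) (suc j′) ∪ ⁅ w ⁆)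
    current j′ cw≡j′ =
      indep-⊆ M (∪⁅⁆-lub (class-recolor⊆class w J c (J≢ cw≡j′)) (∈-class⁺ c cw≡j′)) (c-feasible j′)
    others : ∀ j′ → c w ≢ suc j′ → I (class (recolor w J c) (suc j′))
    others j′ _ with J ≟ suc j′
    ... | yes refl = indep-⊆ M (class-recolor⊆class∪⁅⁆ w J c) iS+w
    ... | no J≢j′  = indep-⊆ M (class-recolor⊆class w J c J≢j′) (c-feasible j′)

  unchanged-later : ∀ {v w d} → Invariant v d → Earlier (inj₂ v) (inj₂ w) → d w ≡ c w
  unchanged-later {v} {w} {d} inv v<w with d w ≟ c w
  ... | yes dw≡cw = dw≡cw
  ... | no dw≢cw with changed-earlier inv w dw≢cw
  ...   | inj₁ refl = contradiction v<w EarlierThan-irrefl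
  ...   | inj₂ w<v  = contradiction w<v (EarlierThan-asym v<w)

  replace-current : ∀ {v w d j} → Invariant v d → c v ≡ suc j →
                    ¬ I (class c (suc j) ∪ ⁅ w ⁆) → I ((class c (suc j) - v) ∪ ⁅ w ⁆) →
                    (∀ y → c y ≡ suc j → Earlier (inj₂ y) (inj₂ v) → ¬ I ((class c (suc j) - y) ∪ ⁅ w ⁆)) →
                    I (class d (suc j) ∪ ⁅ w ⁆)
  replace-current {v} {w} {d} {j} inv cv≡J S+w-dep S-v+w-indep no-chord =
    replacement-lifts v∉T (current-class inv j cv≡J) (p∩q⊆q S T) D+w-indep D+v+w-dep
    where
    S T D : Subset n
    S = class c (suc j)
    T = class d (suc j)
    D = S ∩ T
    v∉T : v ∉ T
    v∉T v∈T = current-changed inv (trans (∈-class⁻ d v∈T) (sym cv≡J))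
    D⊆S-v : D ⊆ S - v
    D⊆S-v z∈D = x∈p∧x≢y⇒x∈p-y (p∩q⊆p S T z∈D) λ { refl → v∉T (p∩q⊆q S T z∈D) }
    D+w-indep : I (D ∪ ⁅ w ⁆)
    D+w-indep = indep-⊆ M (∪⁅⁆-monoˡ D⊆S-v) S-v+w-indep
    outside-D+v : ∀ y → y ∈ S → y ∉ D ∪ ⁅ v ⁆ → ¬ I ((S - y) ∪ ⁅ w ⁆)
    outside-D+v y y∈S y∉D+v with changed-earlier inv y (y∉D+v ∘ p⊆p∪q ⁅ v ⁆ ∘ stays)
      where
      stays : d y ≡ c y → y ∈ D
      stays dy≡cy = x∈p∩q⁺ (y∈S , ∈-class⁺ d (trans dy≡cy (∈-class⁻ c y∈S)))
    ... | inj₁ refl = contradiction (x∈p∪⁅x⁆ D y) y∉D+v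
    ... | inj₂ y<v  = no-chord y (∈-class⁻ c y∈S) y<v
    D+v+w-dep : ¬ I ((D ∪ ⁅ v ⁆) ∪ ⁅ w ⁆)
    D+v+w-dep =
      dependent-on-subset (c-feasible j) (∪⁅⁆-lub (p∩q⊆p S T) (∈-class⁺ c cv≡J)) S+w-dep outside-D+v

  invariant-step : ∀ {v w d} → Invariant v d → ChordlessArc (inj₂ v) (inj₂ w) →
                   Invariant w (recolor w (c v) d)
  invariant-step {v} {w} {d} inv ch with ChordlessArc.arc ch
  ... | exch-arc j .w .v w∉S S+w-dep v∈S S-v+w-indep = record
    { current-class     = current
    ; other-classes     = others
    ; changed-earlier   = changed-earlier′
    ; current-changed   = cv≢cw ∘ trans (sym (recolor-updates w (c v) d))
    ; current-colored   = λ dw≡0 → 1+n≢0 (trans (sym cv≡J) (trans (sym (recolor-updates w (c v) d)) dw≡0))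
    ; colored-elsewhere = colored-elsewhere′
    }
    where
    J : ℕ
    J = suc (toℕ j)
    open ChordlessArc ch using (no-chord) renaming (earlier to v<w)
    cv≡J : c v ≡ J
    cv≡J = ∈-class⁻ c v∈S
    cv≢cw : c v ≢ c w
    cv≢cw cv≡cw = w∉S (∈-class⁺ c (trans (sym cv≡cw) cv≡J))
    cv≢ : ∀ {J′} → c w ≡ J′ → c v ≢ J′
    cv≢ cw≡J′ cv≡J′ = cv≢cw (trans cv≡J′ (sym cw≡J′))
    d′ : Coloring n
    d′ = recolor w (c v) d
    current : ∀ j′ → c w ≡ suc j′ → I (class d′ (suc j′) ∪ ⁅ w ⁆)
    current j′ cw≡j′ =
      indep-⊆ M (∪⁅⁆-lub (class-recolor⊆class w (c v) d (cv≢ cw≡j′))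
                         (∈-class⁺ d (trans (unchanged-later inv v<w) cw≡j′)))
                (other-classes inv j′ (cv≢ cw≡j′))
    others : ∀ j′ → c w ≢ suc j′ → I (class d′ (suc j′))
    others j′ _ with c v ≟ suc j′
    ... | no cv≢j′ = indep-⊆ M (class-recolor⊆class w (c v) d cv≢j′) (other-classes inv j′ cv≢j′)
    ... | yes cv≡j′ with refl ← trans (sym cv≡j′) cv≡J =
      indep-⊆ M (class-recolor⊆class∪⁅⁆ w (c v) d)
        (replace-current inv cv≡J S+w-dep S-v+w-indep
          λ y cy≡J y<v S-y+w-indep → no-chord (inj₂ y) (trans cy≡J (sym cv≡J)) y<v
                                       (exch-arc j w y w∉S S+w-dep (∈-class⁺ c cy≡J) S-y+w-indep))
    changed-earlier′ : ∀ x → d′ x ≢ c x → x ≡ w ⊎ Earlier (inj₂ x) (inj₂ w)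
    changed-earlier′ x d′x≢cx with x Fin.≟ w
    ... | yes x≡w = inj₁ x≡w
    ... | no _ with changed-earlier inv x d′x≢cx
    ...   | inj₁ refl = inj₂ v<w
    ...   | inj₂ x<v  = inj₂ (EarlierThan-trans x<v v<w)
    colored-elsewhere′ : ∀ x → x ≢ w → (d′ x ≡ᵇ 0) ≡ (c x ≡ᵇ 0)
    colored-elsewhere′ x x≢w with x Fin.≟ v
    ... | yes refl = trans (cong (_≡ᵇ 0) (recolor-minimal w (c v) d x≢w))
                           (trans (≢0⇒≡ᵇ0≡false (current-colored inv))
                                  (sym (≢0⇒≡ᵇ0≡false (λ cv≡0 → 1+n≢0 (trans (sym cv≡J) cv≡0)))))
    ... | no x≢v = trans (cong (_≡ᵇ 0) (recolor-minimal w (c v) d x≢w)) (colored-elsewhere inv x x≢v)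

  invariant-walk : ∀ {v d} ws {zs u} → Linked (HArc H) (inj₂ v ∷ ws) → Invariant v d →
                   inj₂ v ∷ ws ≡ zs ∷ʳ inj₂ u → Invariant u (shiftAlong c (inj₂ v ∷ ws) d)
  invariant-walk []             {zs}     _        inv P≡ with refl ← ∷ʳ-injectiveʳ [] zs P≡ = inv
  invariant-walk (inj₁ _ ∷ _)            (h ∷ _)  _   _  = contradiction h ¬hArc-into-source
  invariant-walk (inj₂ w ∷ ws)  {[]}     _        _   ()
  invariant-walk (inj₂ w ∷ ws)  {_ ∷ zs} (h ∷ hs) inv P≡ =
    invariant-walk ws hs (invariant-step inv (hArc⇒chordless h)) (∷-injectiveʳ P≡)

  invariant-at-sink : ∀ {P} → IsSourceSinkPath H P → ∃[ u ] (c u ≡ 0 × Invariant u (c Δ P))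
  invariant-at-sink (_ , _ , (j , [] , refl) , (u , zs , P≡ , _)) with () ← ∷ʳ-injectiveʳ [] zs P≡
  invariant-at-sink (h ∷ _ , _ , (j , inj₁ _ ∷ _ , refl) , _) = contradiction h ¬hArc-into-source
  invariant-at-sink (_ , _ , (j , inj₂ w ∷ ws , refl) , (u , [] , () , _))
  invariant-at-sink (h ∷ hs , _ , (j , inj₂ w ∷ ws , refl) , (u , _ ∷ zs , P≡ , cu≡0)) =
    u , cu≡0 ,
    invariant-walk ws hs (invariant-start (ChordlessArc.arc (hArc⇒chordless h))) (∷-injectiveʳ P≡)

  feasible-at-sink : ∀ {u d} → c u ≡ 0 → Invariant u d → Feasible I d
  feasible-at-sink cu≡0 inv j = other-classes inv j (0≢1+n ∘ trans (sym cu≡0))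

  one-more-colored-at-sink : ∀ {u d} → c u ≡ 0 → Invariant u d → ∣ colored d ∣ ≡ suc ∣ colored c ∣
  one-more-colored-at-sink {u} cu≡0 inv =
    ∣tabulate∣-flip _ _ u (λ x x≢u → cong not (sym (colored-elsewhere inv x x≢u)))
      (cong (not ∘ (_≡ᵇ 0)) cu≡0) (cong not (≢0⇒≡ᵇ0≡false (current-colored inv)))

  shift-along-path : ∀ {P} → IsSourceSinkPath H P →
                     Feasible I (c Δ P) × ∣ colored (c Δ P) ∣ ≡ suc ∣ colored c ∣
  shift-along-path path with u , cu≡0 , inv ← invariant-at-sink path =
    feasible-at-sink cu≡0 inv , one-more-colored-at-sink cu≡0 inv

sourceSinkPath-nonempty : ∀ {I : IndepPred n} {K B c} {H : ColorChordless I K B c} {P} →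
                          IsSourceSinkPath H P → 0 < length P
sourceSinkPath-nonempty (_ , _ , (_ , _ , refl) , _) = s≤s z≤n

lemma4p7 : ∀ {n} (M₁ : Matroid n) (k′ : ℕ) (Ms : Fin k′ → PartitionMatroid n)
    (α : ℕ) (χs : Fin k′ → ℕ) →
    IsChromaticNumber (Indep M₁) α →
    (∀ r → IsChromaticNumber (IndepP (Ms r)) (χs r)) →
    (c : Coloring n) (i : ℕ) →
    ColorsIn (α + ∑ (λ r → χs r ∸ 1)) c →
    Feasible (Indep M₁) c →
    (∀ r → Feasible (IndepP (Ms r)) c) →
    ∣ colored c ∣ ≡ i →
    (H : ColorChordless (Indep M₁) (α + ∑ (λ r → χs r ∸ 1)) (∑ (λ r → χs r ∸ 1)) c) →
    (P : List (Vertex (α + ∑ (λ r → χs r ∸ 1)) n)) →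
    IsSourceSinkPath H P →
    (∀ r → SuffixFeasible (IndepP (Ms r)) c P) →
    ColorsIn (α + ∑ (λ r → χs r ∸ 1)) (c Δ P) ×
    Feasible (Indep M₁) (c Δ P) ×
    (∀ r → Feasible (IndepP (Ms r)) (c Δ P)) ×
    ∣ colored (c Δ P) ∣ ≡ suc i
lemma4p7 M₁ _ _ _ _ _ _ c _ c-in c-feasible _ refl H P path suffix-feasible =
  Δ-colorsIn P c-in ,
  proj₁ shifted ,
  (λ r → suffix-feasible r 0 (sourceSinkPath-nonempty {H = H} path)) ,
  proj₂ shifted
  where
  shifted : Feasible (Indep M₁) (c Δ P) × ∣ colored (c Δ P) ∣ ≡ suc ∣ colored c ∣
  shifted = Walk.shift-along-path M₁ c H c-feasible path
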